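{- Let $H$ be a graph with vertex set $\{v_1,\dots,v_{n(H)}\}$, let $\mathcal{X}=\{X_i:1\le i\le n(H)\}$ be a family of graphs, each with at least one vertex, and let $G=H\circ\mathcal{X}$. Then $G$ is a König–Egerváry graph with a unique perfect matching if and only if each $X_i$ is a König–Egerváry graph with a unique almost perfect matching.
   Context: All graphs are finite, simple and undirected. A graph $G$ is König–Egerváry if $\alpha(G)+\mu(G)=n(G)$, where $\alpha$ is the independence number, $\mu$ the maximum matching size and $n(G)$ the number of vertices. A perfect matching saturates all vertices; an almost perfect matching is a matching leaving exactly one vertex unsaturated. The corona $H\circ\mathcal{X}$ is obtained from the disjoint union of $H$ and $X_1,\dots,X_{n(H)}$ by joining each $v_i$ to all vertices of $X_i$. -}

module Defs where

open import Data.Nat using (ℕ; zero; suc; _+_; _≤_; ⌊_/2⌋)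
open import Data.Bool using (Bool; true; false)
open import Data.Fin using (Fin; splitAt)
open import Data.Fin.Properties using (_≟_)
open import Data.Fin.Subset using (Subset; _∈_; ∣_∣)
open import Data.Vec using (tabulate)
open import Data.Maybe using (Maybe; just; nothing; is-just)
open import Data.Sum using (_⊎_; inj₁; inj₂)
open import Data.Product using (Σ; Σ-syntax; ∃; _×_; _,_)
open import Relation.Nullary using (yes; no; ¬_)
open import Relation.Binary.PropositionalEquality using (_≡_; _≢_; refl; sym)
open import Data.Empty using (⊥-elim)

record Graph : Set where
  field
    n      : ℕ
    adj    : Fin n → Fin n → Bool
    adj-sym    : ∀ i j → adj i j ≡ adj j i
    adj-irrefl : ∀ i → adj i i ≡ false
open Graph public

Independent : (G : Graph) → Subset (n G) → Set
Independent G S = ∀ i j → i ∈ S → j ∈ S → adj G i j ≡ false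

IsIndependenceNumber : Graph → ℕ → Set
IsIndependenceNumber G k =
  (Σ[ S ∈ Subset (n G) ] (Independent G S × ∣ S ∣ ≡ k))
  × (∀ S → Independent G S → ∣ S ∣ ≤ k)

-- Matchings, encoded by the partner map: partner i = just j iff the edge
-- ij is in the matching (nothing = i unsaturated).

record Matching (G : Graph) : Set where
  field
    partner : Fin (n G) → Maybe (Fin (n G))
    valid   : ∀ i j → partner i ≡ just j → (partner j ≡ just i) × (adj G i j ≡ true)
open Matching public

saturated : {G : Graph} → Matching G → Subset (n G)
saturated M = tabulate (λ i → is-just (partner M i))

size : {G : Graph} → Matching G → ℕ
size M = ⌊ ∣ saturated M ∣ /2⌋

IsMatchingNumber : Graph → ℕ → Set
IsMatchingNumber G k =
  (Σ[ M ∈ Matching G ] size M ≡ k) × (∀ (M : Matching G) → size M ≤ k)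

KönigEgerváry : Graph → Set
KönigEgerváry G =
  Σ[ a ∈ ℕ ] Σ[ m ∈ ℕ ] (IsIndependenceNumber G a × IsMatchingNumber G m × a + m ≡ n G)

Saturates : {G : Graph} → Matching G → Fin (n G) → Set
Saturates M i = ∃ λ j → partner M i ≡ just j

Perfect : {G : Graph} → Matching G → Set
Perfect {G} M = ∀ i → Saturates M i

AlmostPerfect : {G : Graph} → Matching G → Set
AlmostPerfect {G} M =
  Σ[ v ∈ Fin (n G) ] (partner M v ≡ nothing × (∀ i → i ≢ v → Saturates M i))

SameMatching : {G : Graph} → Matching G → Matching G → Set
SameMatching {G} M M' = ∀ i → partner M i ≡ partner M' i

HasUnique : (G : Graph) → (Matching G → Set) → Set
HasUnique G P = Σ[ M ∈ Matching G ] (P M × (∀ M' → P M' → SameMatching M' M))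

HasUniquePerfectMatching : Graph → Set
HasUniquePerfectMatching G = HasUnique G Perfect

HasUniqueAlmostPerfectMatching : Graph → Set
HasUniqueAlmostPerfectMatching G = HasUnique G AlmostPerfect

-- Corona H ∘ X.  Vertex set: Fin (n H + total), where the first n H vertices
-- are v_1..v_{n(H)} of H, followed by the vertices of X_1, ..., X_{n(H)}.

total : (h : ℕ) → (Fin h → ℕ) → ℕ
total zero f = 0
total (suc h) f = f Fin.zero + total h (λ i → f (Fin.suc i))

decodeΣ : (h : ℕ) (f : Fin h → ℕ) → Fin (total h f) → Σ (Fin h) (λ i → Fin (f i))
decodeΣ (suc h) f x with splitAt (f Fin.zero) x
... | inj₁ a = Fin.zero , a
... | inj₂ b with decodeΣ h (λ i → f (Fin.suc i)) b
...   | i , c = Fin.suc i , c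

CV : (H : Graph) → (Fin (n H) → Graph) → Set
CV H X = Fin (n H) ⊎ Σ (Fin (n H)) (λ i → Fin (n (X i)))

eqB : ∀ {h} → Fin h → Fin h → Bool
eqB a b with a ≟ b
... | yes _ = true
... | no _ = false

eqB-sym : ∀ {h} (a b : Fin h) → eqB a b ≡ eqB b a
eqB-sym a b with a ≟ b | b ≟ a
... | yes _ | yes _ = refl
... | no _ | no _ = refl
... | yes p | no q = ⊥-elim (q (sym p))
... | no p | yes q = ⊥-elim (p (sym q))

adjXX : {h : ℕ} (X : Fin h → Graph) (i j : Fin h) → Fin (n (X i)) → Fin (n (X j)) → Bool
adjXX X i j c d with i ≟ j
... | yes refl = adj (X i) c d
... | no _ = false

adjXX-sym : {h : ℕ} (X : Fin h → Graph) (i j : Fin h) (c : Fin (n (X i))) (d : Fin (n (X j))) →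
            adjXX X i j c d ≡ adjXX X j i d c
adjXX-sym X i j c d with i ≟ j | j ≟ i
... | yes refl | yes refl = adj-sym (X i) c d
... | no _ | no _ = refl
... | yes p | no q = ⊥-elim (q (sym p))
... | no p | yes q = ⊥-elim (p (sym q))

adjXX-irrefl : {h : ℕ} (X : Fin h → Graph) (i : Fin h) (c : Fin (n (X i))) → adjXX X i i c c ≡ false
adjXX-irrefl X i c with i ≟ i
... | yes refl = adj-irrefl (X i) c
... | no p = ⊥-elim (p refl)

adjCV : (H : Graph) (X : Fin (n H) → Graph) → CV H X → CV H X → Bool
adjCV H X (inj₁ a) (inj₁ b) = adj H a b
adjCV H X (inj₁ a) (inj₂ (i , c)) = eqB a i
adjCV H X (inj₂ (i , c)) (inj₁ a) = eqB i a
adjCV H X (inj₂ (i , c)) (inj₂ (j , d)) = adjXX X i j c d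

adjCV-sym : (H : Graph) (X : Fin (n H) → Graph) (u v : CV H X) → adjCV H X u v ≡ adjCV H X v u
adjCV-sym H X (inj₁ a) (inj₁ b) = adj-sym H a b
adjCV-sym H X (inj₁ a) (inj₂ (i , c)) = eqB-sym a i
adjCV-sym H X (inj₂ (i , c)) (inj₁ a) = eqB-sym i a
adjCV-sym H X (inj₂ (i , c)) (inj₂ (j , d)) = adjXX-sym X i j c d

adjCV-irrefl : (H : Graph) (X : Fin (n H) → Graph) (u : CV H X) → adjCV H X u u ≡ false
adjCV-irrefl H X (inj₁ a) = adj-irrefl H a
adjCV-irrefl H X (inj₂ (i , c)) = adjXX-irrefl X i c

decodeC : (H : Graph) (X : Fin (n H) → Graph) → Fin (n H + total (n H) (λ i → n (X i))) → CV H X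
decodeC H X x with splitAt (n H) x
... | inj₁ a = inj₁ a
... | inj₂ b = inj₂ (decodeΣ (n H) (λ i → n (X i)) b)

corona : (H : Graph) → (Fin (n H) → Graph) → Graph
corona H X = record
  { n = n H + total (n H) (λ i → n (X i))
  ; adj = λ x y → adjCV H X (decodeC H X x) (decodeC H X y)
  ; adj-sym = λ x y → adjCV-sym H X (decodeC H X x) (decodeC H X y)
  ; adj-irrefl = λ x → adjCV-irrefl H X (decodeC H X x)
  }

{-# OPTIONS --safe #-}
-- An independent set T and a matching N satisfy |T| + |N| ≤ n, because every edge of N has at
-- most one end in T; equality holds exactly when T contains every vertex left unsaturated by N
-- and meets every edge of N. So a graph is König–Egerváry iff some independent set covers some
-- matching in this sense, and then a maximum independent set covers every maximum matching.
--
-- A perfect matching of the corona matches every v_k into its own copy X_k: by parity when the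
-- X_k have almost perfect matchings, and, when the corona is König–Egerváry, because an edge
-- v_k v_j with v_k in the cover would force the matching edge inside X_k at some vertex of X_k
-- to meet the cover, although both of its ends are adjacent to v_k. Such perfect matchings are
-- exactly the choices of an almost perfect matching in every X_k, completed by the edges from
-- v_k to the unsaturated vertex, and covers pass between the corona and the copies: the union
-- of covers of the X_k covers the corona, and a cover of the corona, restricted to X_k and
-- enlarged by the vertex matched to v_k, covers X_k.
module Submission where

open import Defs
open import Data.Bool using (Bool; true; false; if_then_else_; _∧_; _∨_)
open import Data.Bool.Properties using (∨-zeroʳ; ∨-identityʳ)
open import Data.Empty using (⊥; ⊥-elim)
open import Data.Fin using (Fin; zero; suc; toℕ; fromℕ<; punchIn; splitAt; _↑ˡ_; _↑ʳ_)
open import Data.Fin.Permutation using (permutation)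
open import Data.Fin.Properties
  using (_≟_; toℕ-injective; punchInᵢ≢i; splitAt-↑ˡ; splitAt-↑ʳ; splitAt⁻¹-↑ˡ; splitAt⁻¹-↑ʳ)
open import Data.Fin.Subset using (Subset; ∣_∣)
open import Data.Fin.Subset.Properties using (∣p∣≤n)
open import Data.Maybe using (Maybe; just; nothing; is-just; fromMaybe; maybe′; map)
open import Data.Nat using (ℕ; zero; suc; _+_; _*_; _≤_; _<ᵇ_; ⌊_/2⌋; z≤n; s≤s)
open import Data.Nat.Properties
  using (+-0-commutativeMonoid; ≤-refl; ≤-reflexive; ≤-trans; ≤-antisym; n≤1+n; m<1+n⇒m≤n;
         ≤∧≢⇒<; +-identityʳ; *-identityʳ; +-mono-≤; +-monoʳ-≤; +-cancelˡ-≡; +-cancelˡ-≤;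
         +-cancelʳ-≤; *-cancelʳ-≡; *-cancelʳ-≤; *-cancelˡ-≤; n≡⌊n+n/2⌋; even≢odd;
         module ≤-Reasoning)
open import Data.Nat.Solver using (module +-*-Solver)
open import Data.Product using (Σ; Σ-syntax; ∃; _×_; _,_; proj₁; proj₂)
open import Data.Sum using (_⊎_; inj₁; inj₂)
open import Data.Vec using (tabulate; lookup)
open import Data.Vec.Properties using (tabulate∘lookup; lookup∘tabulate; []=⇒lookup; lookup⇒[]=)
open import Function using (_∘_; _⇔_; mk⇔; Equivalence; _↔_; mk↔ₛ′; Inverse)
open import Relation.Binary.PropositionalEquality
open import Relation.Nullary using (¬_; contradiction; yes; no)

open +-*-Solver using (solve; _:+_; _:*_; con; _:=_)
open import Algebra.Properties.CommutativeMonoid.Sum +-0-commutativeMonoid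
  using (sum; sum-permute; sum-cong-≗; sum-remove; ∑-distrib-+)

indicator : Bool → ℕ
indicator b = if b then 1 else 0

count : ∀ {m} → (Fin m → Bool) → ℕ
count f = sum (indicator ∘ f)

∣tabulate∣≡count : ∀ {m} (f : Fin m → Bool) → ∣ tabulate f ∣ ≡ count f
∣tabulate∣≡count {zero}  f = refl
∣tabulate∣≡count {suc m} f with f zero
... | true  = cong suc (∣tabulate∣≡count (f ∘ suc))
... | false = ∣tabulate∣≡count (f ∘ suc)

∣p∣≡count-lookup : ∀ {m} (p : Subset m) → ∣ p ∣ ≡ count (lookup p)
∣p∣≡count-lookup p = trans (cong ∣_∣ (sym (tabulate∘lookup p))) (∣tabulate∣≡count (lookup p))

sum-involution : ∀ {m} (q : Fin m → Fin m) → (∀ x → q (q x) ≡ x) →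
                 (f : Fin m → ℕ) → sum (f ∘ q) ≡ sum f
sum-involution q involutive f = sym (sum-permute f (permutation q q involutive involutive))

sum-const : ∀ m c → sum {m} (λ _ → c) ≡ m * c
sum-const zero    c = refl
sum-const (suc m) c = cong (c +_) (sum-const m c)

sum≤m*c : ∀ {m c} (f : Fin m → ℕ) → (∀ i → f i ≤ c) → sum f ≤ m * c
sum≤m*c {zero}  f f≤c = z≤n
sum≤m*c {suc m} f f≤c = +-mono-≤ (f≤c zero) (sum≤m*c (f ∘ suc) (f≤c ∘ suc))

≤-+-≡⇒≡ : ∀ {a b c d} → a ≤ c → b ≤ d → a + b ≡ c + d → a ≡ c × b ≡ d
≤-+-≡⇒≡ {a} {b} {c} {d} a≤c b≤d a+b≡c+d =
  a≡c , +-cancelˡ-≡ c b d (trans (cong (_+ b) (sym a≡c)) a+b≡c+d)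
  where
  a≡c : a ≡ c
  a≡c = ≤-antisym a≤c (+-cancelʳ-≤ d c a
          (≤-trans (≤-reflexive (sym a+b≡c+d)) (+-monoʳ-≤ a b≤d)))

sum≡m*c⇒≡c : ∀ {m c} (f : Fin m → ℕ) → (∀ i → f i ≤ c) → sum f ≡ m * c → ∀ i → f i ≡ c
sum≡m*c⇒≡c {suc m} f f≤c Σf≡ i with ≤-+-≡⇒≡ (f≤c zero) (sum≤m*c (f ∘ suc) (f≤c ∘ suc)) Σf≡
sum≡m*c⇒≡c {suc m} f f≤c Σf≡ zero    | f₀≡c , _   = f₀≡c
sum≡m*c⇒≡c {suc m} f f≤c Σf≡ (suc i) | _    , Σf′≡ = sum≡m*c⇒≡c (f ∘ suc) (f≤c ∘ suc) Σf′≡ i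

count-true : ∀ {m} (f : Fin m → Bool) → (∀ i → f i ≡ true) → count f ≡ m
count-true {m} f f≡true = begin
  count f             ≡⟨ sum-cong-≗ (cong indicator ∘ f≡true) ⟩
  sum {m} (λ _ → 1)   ≡⟨ sum-const m 1 ⟩
  m * 1               ≡⟨ *-identityʳ m ⟩
  m                   ∎
  where open ≡-Reasoning

suc-count-all-but-one : ∀ {m} (f : Fin m → Bool) (v : Fin m) → f v ≡ false →
                        (∀ i → i ≢ v → f i ≡ true) → suc (count f) ≡ m
suc-count-all-but-one {suc m} f v fv≡false f≡true = cong suc (begin
  count f                                   ≡⟨ sum-remove {i = v} (indicator ∘ f) ⟩
  indicator (f v) + count (f ∘ punchIn v)   ≡⟨ cong₂ _+_ (cong indicator fv≡false)
                                                 (count-true _ (f≡true _ ∘ punchInᵢ≢i v)) ⟩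
  m                                         ∎)
  where open ≡-Reasoning

<ᵇ-exclusive : ∀ {a b} → a ≢ b → indicator (a <ᵇ b) + indicator (b <ᵇ a) ≡ 1
<ᵇ-exclusive {zero}  {zero}  a≢b = contradiction refl a≢b
<ᵇ-exclusive {zero}  {suc b} a≢b = refl
<ᵇ-exclusive {suc a} {zero}  a≢b = refl
<ᵇ-exclusive {suc a} {suc b} a≢b = <ᵇ-exclusive (a≢b ∘ cong suc)

∨≡true⇒⊎ : ∀ {a b} → a ∨ b ≡ true → a ≡ true ⊎ b ≡ true
∨≡true⇒⊎ {true}  _      = inj₁ refl
∨≡true⇒⊎ {false} b≡true = inj₂ b≡true

∨-mono-≡true : ∀ {a b} c d → a ∨ b ≡ true → (a ∨ c) ∨ (b ∨ d) ≡ true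
∨-mono-≡true {true}         c d _ = refl
∨-mono-≡true {false} {true} c d _ = ∨-zeroʳ c

update : ∀ {h} {P : Fin h → Set} → (∀ i → P i) → (k : Fin h) → P k → ∀ i → P i
update f k x i with i ≟ k
... | yes refl = x
... | no _     = f i

update-same : ∀ {h} {P : Fin h → Set} (f : ∀ i → P i) k (x : P k) → update f k x k ≡ x
update-same f k x with k ≟ k
... | yes refl = refl
... | no k≢k   = ⊥-elim (k≢k refl)

-- Independent sets covering a matching

Independentᵇ : {V : Set} → (V → V → Bool) → (V → Bool) → Set
Independentᵇ E T = ∀ u v → T u ≡ true → T v ≡ true → E u v ≡ false

Covered : {V : Set} → (V → Bool) → V → Maybe V → Set
Covered T x nothing  = T x ≡ true
Covered T x (just y) = T x ∨ T y ≡ true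

Covers : {V : Set} → (V → Maybe V) → (V → Bool) → Set
Covers partner T = ∀ x → Covered T x (partner x)

module _ {G : Graph} (N : Matching G) where

  saturatedᵇ : Fin (n G) → Bool
  saturatedᵇ x = is-just (partner N x)

  mate : Fin (n G) → Fin (n G)
  mate x = fromMaybe x (partner N x)

  mate-involutive : ∀ x → mate (mate x) ≡ x
  mate-involutive x with partner N x in x↦
  ... | nothing rewrite x↦ = refl
  ... | just y  rewrite proj₁ (valid N x y x↦) = refl

  matched-distinct : ∀ {x y} → partner N x ≡ just y → x ≢ y
  matched-distinct {x} x↦x refl with trans (sym (proj₂ (valid N x x x↦x))) (adj-irrefl G x)
  ... | ()

  -- Counting each matching edge at its end of smaller index halves the saturated vertices.
  lower : Fin (n G) → Bool
  lower x = saturatedᵇ x ∧ (toℕ x <ᵇ toℕ (mate x))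

  saturated-splits : ∀ x → indicator (saturatedᵇ x) ≡ indicator (lower x) + indicator (lower (mate x))
  saturated-splits x with partner N x in x↦
  ... | nothing rewrite x↦ = refl
  ... | just y  rewrite proj₁ (valid N x y x↦) =
    sym (<ᵇ-exclusive (matched-distinct x↦ ∘ toℕ-injective))

  ∣saturated∣≡2*size : ∣ saturated N ∣ ≡ 2 * size N
  ∣saturated∣≡2*size = begin
    ∣ saturated N ∣   ≡⟨ ∣saturated∣≡h+h ⟩
    h + h             ≡⟨ cong (λ k → k + k) h≡size ⟩
    size N + size N   ≡⟨ cong (size N +_) (+-identityʳ (size N)) ⟨
    2 * size N        ∎
    where
    open ≡-Reasoning
    h : ℕ
    h = count lower
    ∣saturated∣≡h+h : ∣ saturated N ∣ ≡ h + h
    ∣saturated∣≡h+h = begin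
      ∣ saturated N ∣
        ≡⟨ ∣tabulate∣≡count saturatedᵇ ⟩
      count saturatedᵇ
        ≡⟨ sum-cong-≗ saturated-splits ⟩
      sum (λ x → indicator (lower x) + indicator (lower (mate x)))
        ≡⟨ ∑-distrib-+ (indicator ∘ lower) (indicator ∘ lower ∘ mate) ⟩
      h + sum (indicator ∘ lower ∘ mate)
        ≡⟨ cong (h +_) (sum-involution mate mate-involutive (indicator ∘ lower)) ⟩
      h + h
        ∎
    h≡size : h ≡ size N
    h≡size = trans (n≡⌊n+n/2⌋ h) (cong ⌊_/2⌋ (sym ∣saturated∣≡h+h))

  -- Summed over x, coverage counts every vertex of T twice and every edge of N twice, while
  -- each term is at most 2 with equality exactly where T covers N.
  coverage : (Fin (n G) → Bool) → Fin (n G) → ℕ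
  coverage T x = indicator (T x) + indicator (T (mate x)) + indicator (saturatedᵇ x)

  sum-coverage : ∀ T → sum (coverage T) ≡ (count T + size N) * 2
  sum-coverage T = begin
    sum (coverage T)
      ≡⟨ ∑-distrib-+ (λ x → indicator (T x) + indicator (T (mate x))) (indicator ∘ saturatedᵇ) ⟩
    sum (λ x → indicator (T x) + indicator (T (mate x))) + count saturatedᵇ
      ≡⟨ cong (_+ count saturatedᵇ) (∑-distrib-+ (indicator ∘ T) (indicator ∘ T ∘ mate)) ⟩
    count T + sum (indicator ∘ T ∘ mate) + count saturatedᵇ
      ≡⟨ cong₂ (λ k l → count T + k + l) (sum-involution mate mate-involutive (indicator ∘ T))
                                         (sym (∣tabulate∣≡count saturatedᵇ)) ⟩
    count T + count T + ∣ saturated N ∣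
      ≡⟨ cong (count T + count T +_) ∣saturated∣≡2*size ⟩
    count T + count T + 2 * size N
      ≡⟨ solve 2 (λ t s → t :+ t :+ con 2 :* s := (t :+ s) :* con 2) refl (count T) (size N) ⟩
    (count T + size N) * 2
      ∎
    where open ≡-Reasoning

  module _ {T : Fin (n G) → Bool} (independent : Independentᵇ (adj G) T) where

    coverage≤2 : ∀ x → coverage T x ≤ 2
    coverage≤2 x with partner N x in x↦
    ... | nothing with T x
    ...   | true  = ≤-refl
    ...   | false = z≤n
    coverage≤2 x | just y with T x in x∈T | T y in y∈T
    ... | true  | true  with trans (sym (proj₂ (valid N x y x↦))) (independent x y x∈T y∈T)
    ...   | ()
    coverage≤2 x | just y | true  | false = ≤-refl
    coverage≤2 x | just y | false | true  = ≤-refl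
    coverage≤2 x | just y | false | false = s≤s z≤n

    coverage≡2⇔covered : ∀ x → coverage T x ≡ 2 ⇔ Covered T x (partner N x)
    coverage≡2⇔covered x with partner N x in x↦
    ... | nothing with T x
    ...   | true  = mk⇔ (λ _ → refl) (λ _ → refl)
    ...   | false = mk⇔ (λ ()) (λ ())
    coverage≡2⇔covered x | just y with T x in x∈T | T y in y∈T
    ... | true  | true  with trans (sym (proj₂ (valid N x y x↦))) (independent x y x∈T y∈T)
    ...   | ()
    coverage≡2⇔covered x | just y | true  | false = mk⇔ (λ _ → refl) (λ _ → refl)
    coverage≡2⇔covered x | just y | false | true  = mk⇔ (λ _ → refl) (λ _ → refl)
    coverage≡2⇔covered x | just y | false | false = mk⇔ (λ ()) (λ ())

    count+size≤order : count T + size N ≤ n G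
    count+size≤order = *-cancelʳ-≤ (count T + size N) (n G) 2 (begin
      (count T + size N) * 2   ≡⟨ sum-coverage T ⟨
      sum (coverage T)         ≤⟨ sum≤m*c (coverage T) coverage≤2 ⟩
      n G * 2                  ∎)
      where open ≤-Reasoning

    count+size≡order⇔covers : count T + size N ≡ n G ⇔ Covers (partner N) T
    count+size≡order⇔covers = mk⇔ tight⇒covers covers⇒tight
      where
      tight⇒covers : count T + size N ≡ n G → Covers (partner N) T
      tight⇒covers tight x = Equivalence.to (coverage≡2⇔covered x)
        (sum≡m*c⇒≡c (coverage T) coverage≤2 (trans (sum-coverage T) (cong (_* 2) tight)) x)
      covers⇒tight : Covers (partner N) T → count T + size N ≡ n G
      covers⇒tight covers = *-cancelʳ-≡ (count T + size N) (n G) 2 (begin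
        (count T + size N) * 2   ≡⟨ sum-coverage T ⟨
        sum (coverage T)         ≡⟨ sum-cong-≗ (λ x → Equivalence.from (coverage≡2⇔covered x) (covers x)) ⟩
        sum {n G} (λ _ → 2)      ≡⟨ sum-const (n G) 2 ⟩
        n G * 2                  ∎)
        where open ≡-Reasoning

Maximum : {G : Graph} → Matching G → Set
Maximum {G} N = ∀ (M : Matching G) → size M ≤ size N

module _ {G : Graph} where

  Independent⇒Independentᵇ : ∀ {S} → Independent G S → Independentᵇ (adj G) (lookup S)
  Independent⇒Independentᵇ independent x y x∈S y∈S =
    independent x y (lookup⇒[]= x _ x∈S) (lookup⇒[]= y _ y∈S)

  Independentᵇ⇒Independent : ∀ {T} → Independentᵇ (adj G) T → Independent G (tabulate T)
  Independentᵇ⇒Independent {T} independent x y x∈T y∈T =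
    independent x y (trans (sym (lookup∘tabulate T x)) ([]=⇒lookup x∈T))
                    (trans (sym (lookup∘tabulate T y)) ([]=⇒lookup y∈T))

  cover⇒KönigEgerváry : ∀ (N : Matching G) {T} → Independentᵇ (adj G) T → Covers (partner N) T →
                        KönigEgerváry G
  cover⇒KönigEgerváry N {T} independent covers =
    count T , size N ,
    ((tabulate T , Independentᵇ⇒Independent independent , ∣tabulate∣≡count T) , α-maximum) ,
    ((N , refl) , μ-maximum) ,
    tight
    where
    tight : count T + size N ≡ n G
    tight = Equivalence.from (count+size≡order⇔covers N independent) covers
    α-maximum : ∀ S → Independent G S → ∣ S ∣ ≤ count T
    α-maximum S S-independent = +-cancelʳ-≤ (size N) ∣ S ∣ (count T) (begin
      ∣ S ∣ + size N              ≡⟨ cong (_+ size N) (∣p∣≡count-lookup S) ⟩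
      count (lookup S) + size N   ≤⟨ count+size≤order N (Independent⇒Independentᵇ S-independent) ⟩
      n G                         ≡⟨ tight ⟨
      count T + size N            ∎)
      where open ≤-Reasoning
    μ-maximum : Maximum N
    μ-maximum M = +-cancelˡ-≤ (count T) (size M) (size N)
      (≤-trans (count+size≤order M independent) (≤-reflexive (sym tight)))

  KönigEgerváry⇒cover : KönigEgerváry G → (N : Matching G) → Maximum N →
                        Σ[ T ∈ (Fin (n G) → Bool) ] Independentᵇ (adj G) T × Covers (partner N) T
  KönigEgerváry⇒cover (α , μ , ((S , S-independent , ∣S∣≡α) , _) , ((M , size≡μ) , μ-maximum) , α+μ≡n)
                      N N-maximum =
    lookup S , independent , Equivalence.to (count+size≡order⇔covers N independent) tight
    where
    independent : Independentᵇ (adj G) (lookup S)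
    independent = Independent⇒Independentᵇ S-independent
    size≡μ′ : size N ≡ μ
    size≡μ′ = ≤-antisym (μ-maximum N) (subst (_≤ size N) size≡μ (N-maximum M))
    tight : count (lookup S) + size N ≡ n G
    tight = begin
      count (lookup S) + size N   ≡⟨ cong₂ _+_ (trans (sym (∣p∣≡count-lookup S)) ∣S∣≡α) size≡μ′ ⟩
      α + μ                       ≡⟨ α+μ≡n ⟩
      n G                         ∎
      where open ≡-Reasoning

-- Parity of perfect and almost perfect matchings

2*size≤order : {G : Graph} (N : Matching G) → 2 * size N ≤ n G
2*size≤order {G} N = subst (_≤ n G) (∣saturated∣≡2*size N) (∣p∣≤n (saturated N))

module _ {G : Graph} (N : Matching G) where

  perfect⇒order≡2*size : Perfect N → n G ≡ 2 * size N
  perfect⇒order≡2*size perfect = begin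
    n G                   ≡⟨ count-true (saturatedᵇ N) (λ x → cong is-just (proj₂ (perfect x))) ⟨
    count (saturatedᵇ N)  ≡⟨ ∣tabulate∣≡count (saturatedᵇ N) ⟨
    ∣ saturated N ∣       ≡⟨ ∣saturated∣≡2*size N ⟩
    2 * size N            ∎
    where open ≡-Reasoning

  almostPerfect⇒order≡1+2*size : AlmostPerfect N → n G ≡ suc (2 * size N)
  almostPerfect⇒order≡1+2*size (v , v-unsaturated , saturates) = begin
    n G                          ≡⟨ suc-count-all-but-one (saturatedᵇ N) v (cong is-just v-unsaturated)
                                      (λ x x≢v → cong is-just (proj₂ (saturates x x≢v))) ⟨
    suc (count (saturatedᵇ N))   ≡⟨ cong suc (∣tabulate∣≡count (saturatedᵇ N)) ⟨
    suc ∣ saturated N ∣          ≡⟨ cong suc (∣saturated∣≡2*size N) ⟩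
    suc (2 * size N)             ∎
    where open ≡-Reasoning

  almostPerfect-unsaturated : ((v , _) : AlmostPerfect N) → ∀ {x} → partner N x ≡ nothing → x ≡ v
  almostPerfect-unsaturated (v , _ , saturates) {x} x-unsaturated with x ≟ v
  ... | yes x≡v = x≡v
  ... | no x≢v with trans (sym x-unsaturated) (proj₂ (saturates x x≢v))
  ...   | ()

  order≤1+2*size⇒maximum : n G ≤ suc (2 * size N) → Maximum N
  order≤1+2*size⇒maximum n≤1+2s M = *-cancelˡ-≤ 2 (m<1+n⇒m≤n
    (≤∧≢⇒< (≤-trans (2*size≤order M) n≤1+2s) (even≢odd (size M) (size N))))

  perfect⇒maximum : Perfect N → Maximum N
  perfect⇒maximum perfect =
    order≤1+2*size⇒maximum (≤-trans (≤-reflexive (perfect⇒order≡2*size perfect)) (n≤1+n _))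

  almostPerfect⇒maximum : AlmostPerfect N → Maximum N
  almostPerfect⇒maximum almostPerfect =
    order≤1+2*size⇒maximum (≤-reflexive (almostPerfect⇒order≡1+2*size almostPerfect))

perfect⇒¬almostPerfect : {G : Graph} (M N : Matching G) → Perfect M → ¬ AlmostPerfect N
perfect⇒¬almostPerfect M N perfect almostPerfect = even≢odd (size M) (size N)
  (trans (sym (perfect⇒order≡2*size M perfect)) (almostPerfect⇒order≡1+2*size N almostPerfect))

-- Matchings of a relation on an arbitrary vertex type

record Matching′ {V : Set} (E : V → V → Bool) : Set where
  field
    partner′ : V → Maybe V
    valid′   : ∀ u v → partner′ u ≡ just v → (partner′ v ≡ just u) × (E u v ≡ true)
open Matching′ public

Perfect′ : {V : Set} {E : V → V → Bool} → Matching′ E → Set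
Perfect′ m = ∀ u → ∃ λ v → partner′ m u ≡ just v

UniquePerfect′ : {V : Set} {E : V → V → Bool} → Matching′ E → Set
UniquePerfect′ {E = E} m = ∀ (m′ : Matching′ E) → Perfect′ m′ → ∀ v → partner′ m′ v ≡ partner′ m v

module _ {A B : Set} {f : A → B} {g : B → A} (g∘f : ∀ a → g (f a) ≡ a) where

  map-inverse : ∀ p → map g (map f p) ≡ p
  map-inverse nothing  = refl
  map-inverse (just a) = cong just (g∘f a)

  map≡just⇒≡just : ∀ {p b} → map f p ≡ just b → p ≡ just (g b)
  map≡just⇒≡just {just a} refl = cong just (sym (g∘f a))

  Covered-map : ∀ {T : A → Bool} {x p} → Covered T (g x) p → Covered (T ∘ g) x (map f p)
  Covered-map {p = nothing} covered = covered
  Covered-map {T} {x} {just a} covered = subst (λ y → T (g x) ∨ T y ≡ true) (sym (g∘f a)) covered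

module Transport {V : Set} {E : V → V → Bool} (G : Graph) (vertices : Fin (n G) ↔ V)
                 (adj≡E : ∀ x y → adj G x y ≡ E (Inverse.to vertices x) (Inverse.to vertices y)) where

  open Inverse vertices using (to; from; strictlyInverseˡ; strictlyInverseʳ)

  E≡adj : ∀ u v → E u v ≡ adj G (from u) (from v)
  E≡adj u v = sym (trans (adj≡E (from u) (from v)) (cong₂ E (strictlyInverseˡ u) (strictlyInverseˡ v)))

  toGraph : Matching′ E → Matching G
  toGraph m = record { partner = map from ∘ partner′ m ∘ to ; valid = valid-to }
    where
    valid-to : ∀ x y → map from (partner′ m (to x)) ≡ just y →
               (map from (partner′ m (to y)) ≡ just x) × (adj G x y ≡ true)
    valid-to x y x↦y with valid′ m (to x) (to y) (map≡just⇒≡just strictlyInverseˡ x↦y)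
    ... | y↦x , adjacent =
      trans (cong (map from) y↦x) (cong just (strictlyInverseʳ x)) , trans (adj≡E x y) adjacent

  fromGraph : Matching G → Matching′ E
  fromGraph M = record { partner′ = map to ∘ partner M ∘ from ; valid′ = valid-from }
    where
    valid-from : ∀ u v → map to (partner M (from u)) ≡ just v →
                 (map to (partner M (from v)) ≡ just u) × (E u v ≡ true)
    valid-from u v u↦v with valid M (from u) (from v) (map≡just⇒≡just strictlyInverseʳ u↦v)
    ... | v↦u , adjacent =
      trans (cong (map to) v↦u) (cong just (strictlyInverseˡ u)) , trans (E≡adj u v) adjacent

  toGraph-perfect : ∀ m → Perfect′ m → Perfect (toGraph m)
  toGraph-perfect m perfect x with perfect (to x)
  ... | v , x↦v = from v , cong (map from) x↦v

  fromGraph-perfect : ∀ M → Perfect M → Perfect′ (fromGraph M)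
  fromGraph-perfect M perfect u with perfect (from u)
  ... | y , u↦y = to y , cong (map to) u↦y

  uniquePerfect-fromGraph : ∀ M → (∀ M′ → Perfect M′ → SameMatching M′ M) → UniquePerfect′ (fromGraph M)
  uniquePerfect-fromGraph M unique m perfect u = begin
    partner′ m u
      ≡⟨ cong (partner′ m) (strictlyInverseˡ u) ⟨
    partner′ m (to (from u))
      ≡⟨ map-inverse strictlyInverseˡ _ ⟨
    map to (map from (partner′ m (to (from u))))
      ≡⟨ cong (map to) (unique (toGraph m) (toGraph-perfect m perfect) (from u)) ⟩
    map to (partner M (from u))
      ∎
    where open ≡-Reasoning

  uniquePerfect-toGraph : ∀ m → UniquePerfect′ m → ∀ M → Perfect M → SameMatching M (toGraph m)
  uniquePerfect-toGraph m unique M perfect x = begin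
    partner M x
      ≡⟨ map-inverse strictlyInverseʳ _ ⟨
    map from (map to (partner M x))
      ≡⟨ cong (map from ∘ map to ∘ partner M) (strictlyInverseʳ x) ⟨
    map from (partner′ (fromGraph M) (to x))
      ≡⟨ cong (map from) (unique (fromGraph M) (fromGraph-perfect M perfect) (to x)) ⟩
    map from (partner′ m (to x))
      ∎
    where open ≡-Reasoning

  independent-from : ∀ {S} → Independentᵇ (adj G) S → Independentᵇ E (S ∘ from)
  independent-from independent u v u∈S v∈S =
    trans (E≡adj u v) (independent (from u) (from v) u∈S v∈S)

  independent-to : ∀ {T} → Independentᵇ E T → Independentᵇ (adj G) (T ∘ to)
  independent-to independent x y x∈T y∈T = trans (adj≡E x y) (independent (to x) (to y) x∈T y∈T)

  covers-fromGraph : ∀ M {S} → Covers (partner M) S → Covers (partner′ (fromGraph M)) (S ∘ from)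
  covers-fromGraph M covers u = Covered-map strictlyInverseʳ (covers (from u))

  covers-toGraph : ∀ m {T} → Covers (partner′ m) T → Covers (partner (toGraph m)) (T ∘ to)
  covers-toGraph m covers x = Covered-map strictlyInverseˡ (covers (to x))

-- The corona

encodeΣ : (h : ℕ) (f : Fin h → ℕ) → Σ (Fin h) (Fin ∘ f) → Fin (total h f)
encodeΣ (suc h) f (zero  , c) = c ↑ˡ total h (f ∘ suc)
encodeΣ (suc h) f (suc i , c) = f zero ↑ʳ encodeΣ h (f ∘ suc) (i , c)

decodeΣ∘encodeΣ : ∀ h f p → decodeΣ h f (encodeΣ h f p) ≡ p
decodeΣ∘encodeΣ (suc h) f (zero , c) rewrite splitAt-↑ˡ (f zero) c (total h (f ∘ suc)) = refl
decodeΣ∘encodeΣ (suc h) f (suc i , c)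
  rewrite splitAt-↑ʳ (f zero) (total h (f ∘ suc)) (encodeΣ h (f ∘ suc) (i , c))
        | decodeΣ∘encodeΣ h (f ∘ suc) (i , c) = refl

encodeΣ∘decodeΣ : ∀ h f x → encodeΣ h f (decodeΣ h f x) ≡ x
encodeΣ∘decodeΣ (suc h) f x with splitAt (f zero) x in split≡
... | inj₁ a = splitAt⁻¹-↑ˡ split≡
... | inj₂ b with decodeΣ h (f ∘ suc) b | encodeΣ∘decodeΣ h (f ∘ suc) b
...   | i , c | encodeΣ∘decodeΣ≡b = trans (cong (f zero ↑ʳ_) encodeΣ∘decodeΣ≡b) (splitAt⁻¹-↑ʳ split≡)

eqB⇒≡ : ∀ {h} {a b : Fin h} → eqB a b ≡ true → a ≡ b
eqB⇒≡ {a = a} {b} eqB≡true with a ≟ b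
... | yes a≡b = a≡b

eqB-refl : ∀ {h} (a : Fin h) → eqB a a ≡ true
eqB-refl a with a ≟ a
... | yes _  = refl
... | no a≢a = ⊥-elim (a≢a refl)

module _ {h : ℕ} (X : Fin h → Graph) where

  adjXX⇒≡ : ∀ {i j c d} → adjXX X i j c d ≡ true → i ≡ j
  adjXX⇒≡ {i} {j} adjacent with i ≟ j
  ... | yes i≡j = i≡j

  adjXX-diagonal : ∀ i c d → adjXX X i i c d ≡ adj (X i) c d
  adjXX-diagonal i c d with i ≟ i
  ... | yes refl = refl
  ... | no i≢i   = ⊥-elim (i≢i refl)

-- The hub k is the vertex inj₁ k = v_k of H; it is adjacent to every vertex inj₂ (k , c) of X_k.
module Corona (H : Graph) (X : Fin (n H) → Graph) where

  encodeC : CV H X → Fin (n (corona H X))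
  encodeC (inj₁ v) = v ↑ˡ total (n H) (n ∘ X)
  encodeC (inj₂ p) = n H ↑ʳ encodeΣ (n H) (n ∘ X) p

  decodeC∘encodeC : ∀ u → decodeC H X (encodeC u) ≡ u
  decodeC∘encodeC (inj₁ v) rewrite splitAt-↑ˡ (n H) v (total (n H) (n ∘ X)) = refl
  decodeC∘encodeC (inj₂ p) rewrite splitAt-↑ʳ (n H) (total (n H) (n ∘ X)) (encodeΣ (n H) (n ∘ X) p) =
    cong inj₂ (decodeΣ∘encodeΣ (n H) (n ∘ X) p)

  encodeC∘decodeC : ∀ x → encodeC (decodeC H X x) ≡ x
  encodeC∘decodeC x with splitAt (n H) x in split≡
  ... | inj₁ v = splitAt⁻¹-↑ˡ split≡
  ... | inj₂ b = trans (cong (n H ↑ʳ_) (encodeΣ∘decodeΣ (n H) (n ∘ X) b)) (splitAt⁻¹-↑ʳ split≡)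

  corona-vertices : Fin (n (corona H X)) ↔ CV H X
  corona-vertices = mk↔ₛ′ (decodeC H X) encodeC decodeC∘encodeC encodeC∘decodeC

  inCopy : (k : Fin (n H)) → Maybe (CV H X) → Maybe (Fin (n (X k)))
  inCopy k (just (inj₂ (j , d))) with j ≟ k
  ... | yes refl = just d
  ... | no _     = nothing
  inCopy k _ = nothing

  inCopy-copy : ∀ k d → inCopy k (just (inj₂ (k , d))) ≡ just d
  inCopy-copy k d with k ≟ k
  ... | yes refl = refl
  ... | no k≢k   = ⊥-elim (k≢k refl)

  inCopy≡just : ∀ k p {d} → inCopy k p ≡ just d → p ≡ just (inj₂ (k , d))
  inCopy≡just k (just (inj₂ (j , d))) _ with j ≟ k
  inCopy≡just k (just (inj₂ (k , d))) refl | yes refl = refl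

  restrict : Matching′ (adjCV H X) → (k : Fin (n H)) → Matching (X k)
  restrict m k = record { partner = inCopy k ∘ partner′ m ∘ inj₂ ∘ (k ,_) ; valid = valid-restrict }
    where
    valid-restrict : ∀ c d → inCopy k (partner′ m (inj₂ (k , c))) ≡ just d →
                     (inCopy k (partner′ m (inj₂ (k , d))) ≡ just c) × (adj (X k) c d ≡ true)
    valid-restrict c d c↦d with valid′ m _ _ (inCopy≡just k _ c↦d)
    ... | d↦c , adjacent =
      trans (cong (inCopy k) d↦c) (inCopy-copy k c) , trans (sym (adjXX-diagonal X k c d)) adjacent

  module _ (m : Matching′ (adjCV H X)) (perfect : Perfect′ m) where

    copy-partner : ∀ k c → partner′ m (inj₂ (k , c)) ≡ just (inj₁ k) ⊎ Saturates (restrict m k) c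
    copy-partner k c with perfect (inj₂ (k , c))
    ... | inj₁ j , c↦j with eqB⇒≡ (proj₂ (valid′ m _ _ c↦j))
    ...   | refl = inj₁ c↦j
    copy-partner k c | inj₂ (j , d) , c↦d with adjXX⇒≡ X {k} {j} (proj₂ (valid′ m _ _ c↦d))
    ...   | refl = inj₂ (d , trans (cong (inCopy k) c↦d) (inCopy-copy k d))

    restrict-perfect : ∀ {k j} → partner′ m (inj₁ k) ≡ just (inj₁ j) → Perfect (restrict m k)
    restrict-perfect {k} k↦j c with copy-partner k c
    ... | inj₂ c-saturated = c-saturated
    ... | inj₁ c↦k with trans (sym k↦j) (proj₁ (valid′ m _ _ c↦k))
    ...   | ()

    restrict-almostPerfect : ∀ {k c} → partner′ m (inj₁ k) ≡ just (inj₂ (k , c)) →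
                             AlmostPerfect (restrict m k)
    restrict-almostPerfect {k} {c} k↦c = c , c-unsaturated , saturates
      where
      c-unsaturated : inCopy k (partner′ m (inj₂ (k , c))) ≡ nothing
      c-unsaturated rewrite proj₁ (valid′ m _ _ k↦c) = refl
      saturates : ∀ d → d ≢ c → Saturates (restrict m k) d
      saturates d d≢c with copy-partner k d
      ... | inj₂ d-saturated = d-saturated
      ... | inj₁ d↦k with trans (sym k↦c) (proj₁ (valid′ m _ _ d↦k))
      ...   | refl = ⊥-elim (d≢c refl)

    hub-into-copy : ∀ k → (∀ j → partner′ m (inj₁ k) ≢ just (inj₁ j)) →
                    ∃ λ c → partner′ m (inj₁ k) ≡ just (inj₂ (k , c))
    hub-into-copy k not-into-H with perfect (inj₁ k)
    ... | inj₁ j , k↦j = ⊥-elim (not-into-H j k↦j)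
    ... | inj₂ (j , c) , k↦c with eqB⇒≡ (proj₂ (valid′ m _ _ k↦c))
    ...   | refl = c , k↦c

  copyUnion : (∀ k → Fin (n (X k)) → Bool) → CV H X → Bool
  copyUnion T (inj₁ _)       = false
  copyUnion T (inj₂ (k , d)) = T k d

  copyUnion-independent : ∀ {T} → (∀ k → Independentᵇ (adj (X k)) (T k)) →
                          Independentᵇ (adjCV H X) (copyUnion T)
  copyUnion-independent independent (inj₂ (k , c)) (inj₂ (j , d)) c∈T d∈T with k ≟ j
  ... | yes refl = independent k c d c∈T d∈T
  ... | no _     = refl

  AlmostPerfectMatchings : Set
  AlmostPerfectMatchings = ∀ k → Σ (Matching (X k)) AlmostPerfect

  module _ (D : AlmostPerfectMatchings) where

    private
      Q : ∀ k → Matching (X k)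
      Q k = proj₁ (D k)

      u : ∀ k → Fin (n (X k))
      u k = proj₁ (proj₂ (D k))

      u-unsaturated : ∀ k → partner (Q k) (u k) ≡ nothing
      u-unsaturated k = proj₁ (proj₂ (proj₂ (D k)))

    attach : Matching′ (adjCV H X)
    attach = record { partner′ = attached ; valid′ = valid-attached }
      where
      attached : CV H X → Maybe (CV H X)
      attached (inj₁ k)       = just (inj₂ (k , u k))
      attached (inj₂ (k , c)) = just (maybe′ (inj₂ ∘ (k ,_)) (inj₁ k) (partner (Q k) c))

      valid-attached : ∀ v w → attached v ≡ just w → (attached w ≡ just v) × (adjCV H X v w ≡ true)
      valid-attached (inj₁ k) _ refl rewrite u-unsaturated k = refl , eqB-refl k
      valid-attached (inj₂ (k , c)) _ _ with partner (Q k) c in c↦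
      valid-attached (inj₂ (k , c)) _ refl | just d rewrite proj₁ (valid (Q k) c d c↦) =
        refl , trans (adjXX-diagonal X k c d) (proj₂ (valid (Q k) c d c↦))
      valid-attached (inj₂ (k , c)) _ refl | nothing
        rewrite almostPerfect-unsaturated (Q k) (proj₂ (D k)) c↦ = refl , eqB-refl k

    attach-perfect : Perfect′ attach
    attach-perfect (inj₁ k)       = _ , refl
    attach-perfect (inj₂ (k , c)) = _ , refl

    restrict-attach : ∀ k c → partner (restrict attach k) c ≡ partner (Q k) c
    restrict-attach k c with partner (Q k) c
    ... | just d  = inCopy-copy k d
    ... | nothing = refl

    agree-with-attach : (m : Matching′ (adjCV H X)) →
                        (∀ k → partner′ m (inj₁ k) ≡ just (inj₂ (k , u k))) →
                        (∀ k c → partner (restrict m k) c ≡ partner (Q k) c) →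
                        ∀ v → partner′ m v ≡ partner′ attach v
    agree-with-attach m hubs copies (inj₁ k) = hubs k
    agree-with-attach m hubs copies (inj₂ (k , c)) with partner (Q k) c in c↦
    ... | just d  = inCopy≡just k _ (trans (copies k c) c↦)
    ... | nothing rewrite almostPerfect-unsaturated (Q k) (proj₂ (D k)) c↦ =
      proj₁ (valid′ m _ _ (hubs k))

    attach-unique : (∀ k N → AlmostPerfect N → SameMatching N (Q k)) → UniquePerfect′ attach
    attach-unique unique m perfect = agree-with-attach m hubs copies
      where
      into-copy : ∀ k → ∃ λ c → partner′ m (inj₁ k) ≡ just (inj₂ (k , c))
      into-copy k = hub-into-copy m perfect k λ j k↦j →
        perfect⇒¬almostPerfect (restrict m k) (Q k) (restrict-perfect m perfect k↦j) (proj₂ (D k))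
      copies : ∀ k c → partner (restrict m k) c ≡ partner (Q k) c
      copies k = unique k (restrict m k) (restrict-almostPerfect m perfect (proj₂ (into-copy k)))
      hubs : ∀ k → partner′ m (inj₁ k) ≡ just (inj₂ (k , u k))
      hubs k with into-copy k
      ... | c , k↦c = subst (λ c′ → partner′ m (inj₁ k) ≡ just (inj₂ (k , c′))) c≡u k↦c
        where
        c-unsaturated : partner (restrict m k) c ≡ nothing
        c-unsaturated = proj₁ (proj₂ (restrict-almostPerfect m perfect k↦c))
        c≡u : c ≡ u k
        c≡u = almostPerfect-unsaturated (Q k) (proj₂ (D k)) (trans (sym (copies k c)) c-unsaturated)

    attach-covers : ∀ {T} → (∀ k → Covers (partner (Q k)) (T k)) → Covers (partner′ attach) (copyUnion T)
    attach-covers {T} covers (inj₁ k) = subst (Covered (T k) (u k)) (u-unsaturated k) (covers k (u k))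
    attach-covers covers (inj₂ (k , c)) with partner (Q k) c | covers k c
    ... | just d  | covered = covered
    ... | nothing | covered = trans (∨-identityʳ _) covered

  restrictions : (m : Matching′ (adjCV H X)) → Perfect′ m →
                 (∀ k → ∃ λ c → partner′ m (inj₁ k) ≡ just (inj₂ (k , c))) → AlmostPerfectMatchings
  restrictions m perfect hubs k = restrict m k , restrict-almostPerfect m perfect (proj₂ (hubs k))

  -- Attaching N in place of the k-th restriction gives a perfect matching, so it is m itself.
  restrict-unique : (m : Matching′ (adjCV H X)) (perfect : Perfect′ m) → UniquePerfect′ m →
                    (hubs : ∀ k → ∃ λ c → partner′ m (inj₁ k) ≡ just (inj₂ (k , c))) →
                    ∀ k (N : Matching (X k)) → AlmostPerfect N → SameMatching N (restrict m k)
  restrict-unique m perfect unique hubs k N N-almostPerfect c = begin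
    partner N c
      ≡⟨ cong (λ P → partner (proj₁ P) c) (update-same (restrictions m perfect hubs) k N′) ⟨
    partner (proj₁ (D′ k)) c
      ≡⟨ restrict-attach D′ k c ⟨
    inCopy k (partner′ (attach D′) (inj₂ (k , c)))
      ≡⟨ cong (inCopy k) (unique (attach D′) (attach-perfect D′) (inj₂ (k , c))) ⟩
    inCopy k (partner′ m (inj₂ (k , c)))
      ∎
    where
    open ≡-Reasoning
    N′ : Σ (Matching (X k)) AlmostPerfect
    N′ = N , N-almostPerfect
    D′ : AlmostPerfectMatchings
    D′ = update (restrictions m perfect hubs) k N′

  copies⇒perfect-cover : (∀ k → KönigEgerváry (X k) × HasUniqueAlmostPerfectMatching (X k)) →
                         Σ[ m ∈ Matching′ (adjCV H X) ] Perfect′ m × UniquePerfect′ m ×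
                           Σ[ T ∈ (CV H X → Bool) ] Independentᵇ (adjCV H X) T × Covers (partner′ m) T
  copies⇒perfect-cover copies =
    attach D , attach-perfect D , attach-unique D unique ,
    copyUnion (proj₁ ∘ cover) , copyUnion-independent (proj₁ ∘ proj₂ ∘ cover) ,
    attach-covers D (proj₂ ∘ proj₂ ∘ cover)
    where
    D : AlmostPerfectMatchings
    D k = proj₁ (proj₂ (copies k)) , proj₁ (proj₂ (proj₂ (copies k)))
    unique : ∀ k N → AlmostPerfect N → SameMatching N (proj₁ (D k))
    unique k = proj₂ (proj₂ (proj₂ (copies k)))
    cover : ∀ k → Σ[ T ∈ (Fin (n (X k)) → Bool) ]
                    Independentᵇ (adj (X k)) T × Covers (partner (proj₁ (D k))) T
    cover k = KönigEgerváry⇒cover (proj₁ (copies k)) (proj₁ (D k))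
                (almostPerfect⇒maximum (proj₁ (D k)) (proj₂ (D k)))

  module _ (m : Matching′ (adjCV H X)) (perfect : Perfect′ m) {S : CV H X → Bool}
           (independent : Independentᵇ (adjCV H X) S) (covers : Covers (partner′ m) S) where

    edge-covered : ∀ {v w} → partner′ m v ≡ just w → S v ∨ S w ≡ true
    edge-covered {v} v↦w = subst (Covered S v) v↦w (covers v)

    hub∈S⇒copy∉S : ∀ {k c} → S (inj₁ k) ≡ true → S (inj₂ (k , c)) ≡ true → ⊥
    hub∈S⇒copy∉S {k} k∈S c∈S with trans (sym (eqB-refl k)) (independent _ _ k∈S c∈S)
    ... | ()

    hub∈S⇒restrict-imperfect : ∀ {k} → Fin (n (X k)) → S (inj₁ k) ≡ true → ¬ Perfect (restrict m k)
    hub∈S⇒restrict-imperfect {k} c k∈S restrict-perfect with restrict-perfect c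
    ... | d , c↦d with ∨≡true⇒⊎ (edge-covered (inCopy≡just k _ c↦d))
    ...   | inj₁ c∈S = hub∈S⇒copy∉S k∈S c∈S
    ...   | inj₂ d∈S = hub∈S⇒copy∉S k∈S d∈S

    hubs-into-copies : (∀ k → Fin (n (X k))) → ∀ k → ∃ λ c → partner′ m (inj₁ k) ≡ just (inj₂ (k , c))
    hubs-into-copies vertex k = hub-into-copy m perfect k not-into-H
      where
      not-into-H : ∀ j → partner′ m (inj₁ k) ≢ just (inj₁ j)
      not-into-H j k↦j with ∨≡true⇒⊎ (edge-covered k↦j)
      ... | inj₁ k∈S = hub∈S⇒restrict-imperfect (vertex k) k∈S (restrict-perfect m perfect k↦j)
      ... | inj₂ j∈S = hub∈S⇒restrict-imperfect (vertex j) j∈S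
                         (restrict-perfect m perfect (proj₁ (valid′ m _ _ k↦j)))

    module _ {k u} (k↦u : partner′ m (inj₁ k) ≡ just (inj₂ (k , u))) where

      -- S misses u only if the hub k is in S, and then S contains no vertex of X_k at all.
      Sₖ : Fin (n (X k)) → Bool
      Sₖ d = S (inj₂ (k , d)) ∨ eqB d u

      copy∈S⇒u∈S : ∀ {d} → S (inj₂ (k , d)) ≡ true → S (inj₂ (k , u)) ≡ true
      copy∈S⇒u∈S d∈S with ∨≡true⇒⊎ (edge-covered k↦u)
      ... | inj₁ k∈S = ⊥-elim (hub∈S⇒copy∉S k∈S d∈S)
      ... | inj₂ u∈S = u∈S

      copy-independent : ∀ {c d} → S (inj₂ (k , c)) ≡ true → S (inj₂ (k , d)) ≡ true →
                         adj (X k) c d ≡ false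
      copy-independent {c} {d} c∈S d∈S =
        trans (sym (adjXX-diagonal X k c d)) (independent _ _ c∈S d∈S)

      Sₖ-independent : Independentᵇ (adj (X k)) Sₖ
      Sₖ-independent c d c∈Sₖ d∈Sₖ with ∨≡true⇒⊎ c∈Sₖ | ∨≡true⇒⊎ d∈Sₖ
      ... | inj₁ c∈S | inj₁ d∈S = copy-independent c∈S d∈S
      ... | inj₁ c∈S | inj₂ d≡u rewrite eqB⇒≡ d≡u = copy-independent c∈S (copy∈S⇒u∈S c∈S)
      ... | inj₂ c≡u | inj₁ d∈S rewrite eqB⇒≡ c≡u = copy-independent (copy∈S⇒u∈S d∈S) d∈S
      ... | inj₂ c≡u | inj₂ d≡u rewrite eqB⇒≡ c≡u | eqB⇒≡ d≡u = adj-irrefl (X k) u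

      Sₖ-covers : Covers (partner (restrict m k)) Sₖ
      Sₖ-covers c with partner (restrict m k) c in c↦
      ... | just d =
        ∨-mono-≡true {S (inj₂ (k , c))} (eqB c u) (eqB d u) (edge-covered (inCopy≡just k _ c↦))
      ... | nothing
        rewrite almostPerfect-unsaturated (restrict m k) (restrict-almostPerfect m perfect k↦u) c↦ =
        trans (cong (S (inj₂ (k , u)) ∨_) (eqB-refl u)) (∨-zeroʳ _)

    perfect-cover⇒copies : (∀ k → Fin (n (X k))) → UniquePerfect′ m →
                           ∀ k → KönigEgerváry (X k) × HasUniqueAlmostPerfectMatching (X k)
    perfect-cover⇒copies vertex unique k =
      cover⇒KönigEgerváry (restrict m k) (Sₖ-independent k↦u) (Sₖ-covers k↦u) ,
      restrict m k , restrict-almostPerfect m perfect k↦u , restrict-unique m perfect unique hubs k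
      where
      hubs : ∀ k → ∃ λ c → partner′ m (inj₁ k) ≡ just (inj₂ (k , c))
      hubs = hubs-into-copies vertex
      k↦u : partner′ m (inj₁ k) ≡ just (inj₂ (k , proj₁ (hubs k)))
      k↦u = proj₂ (hubs k)

module _ (H : Graph) (X : Fin (n H) → Graph) where

  open Corona H X
  open Transport {E = adjCV H X} (corona H X) corona-vertices (λ _ _ → refl)

  corona⇒copies : (∀ i → 1 ≤ n (X i)) →
                  KönigEgerváry (corona H X) × HasUniquePerfectMatching (corona H X) →
                  ∀ i → KönigEgerváry (X i) × HasUniqueAlmostPerfectMatching (X i)
  corona⇒copies nonempty (ke , M , M-perfect , M-unique)
    with KönigEgerváry⇒cover ke M (perfect⇒maximum M M-perfect)
  ... | S , independent , covers =
    perfect-cover⇒copies (fromGraph M) (fromGraph-perfect M M-perfect)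
      (independent-from independent) (covers-fromGraph M covers)
      (λ i → fromℕ< (nonempty i)) (uniquePerfect-fromGraph M M-unique)

  copies⇒corona : (∀ i → KönigEgerváry (X i) × HasUniqueAlmostPerfectMatching (X i)) →
                  KönigEgerváry (corona H X) × HasUniquePerfectMatching (corona H X)
  copies⇒corona copies with copies⇒perfect-cover copies
  ... | m , perfect , unique , T , independent , covers =
    cover⇒KönigEgerváry (toGraph m) (independent-to independent) (covers-toGraph m covers) ,
    toGraph m , toGraph-perfect m perfect , uniquePerfect-toGraph m unique

corollary2p6 : (H : Graph) (X : Fin (n H) → Graph) →
    (∀ i → 1 ≤ n (X i)) →
    (KönigEgerváry (corona H X) × HasUniquePerfectMatching (corona H X))
      ⇔ (∀ i → KönigEgerváry (X i) × HasUniqueAlmostPerfectMatching (X i))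
corollary2p6 H X nonempty = mk⇔ (corona⇒copies H X nonempty) (copies⇒corona H X)
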